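{- If $\lambda$ is a wide partition, then the set of rows of the Young diagram of $\lambda$ (each row viewed as a complete subgraph) is a uniform clique cover of $L(G_\lambda)$.
   Context: For partitions $\alpha,\beta$ of the same integer, $\alpha\ge\beta$ (dominance) means $\sum_{k\le j}\alpha_k\ge\sum_{k\le j}\beta_k$ for all $j$; $\nu'$ is the conjugate of $\nu$. $\nu$ is a subpartition of $\lambda$ if the multiset of parts of $\nu$ is a submultiset of that of $\lambda$. $\lambda$ is wide if $\nu\ge\nu'$ for every subpartition $\nu$ of $\lambda$. $L(G_\lambda)$ is the graph whose vertices are the cells $(i,j)$, $j\le\lambda_i$, of the Young diagram of $\lambda$, two cells being adjacent iff they lie in the same row or the same column (the line graph of the bipartite row–column graph $G_\lambda$). For a graph $G$, a $k$-clique is a union of $k$ complete subgraphs, $\omega_k$ is the maximum number of vertices of a $k$-clique, $\omega_0=0$, $\Delta\omega_k=\omega_k-\omega_{k-1}$. A clique cover is a family of vertex-disjoint complete subgraphs covering all vertices; with sizes sorted decreasingly as $\nu_1\ge\nu_2\ge\cdots$, it is uniform if $\nu_k=\Delta\omega_k$ for all $k$. -}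

module Defs where

open import Data.Nat using (ℕ; zero; suc; _+_; _≤_; _≥_; _≤?_; _>_)
import Data.Nat.Properties as ℕP
open import Data.Product using (Σ; ∃; _×_; _,_)
open import Data.Product.Properties using (≡-dec)
open import Data.Sum using (_⊎_)
open import Data.List using (List; []; _∷_; length; map; filter; concat; take; upTo; _++_)
open import Data.List.Relation.Unary.All using (All)
open import Data.List.Relation.Unary.Any using (Any; any?)
open import Data.List.Relation.Unary.AllPairs using (AllPairs)
open import Data.List.Relation.Unary.Linked using (Linked)
open import Data.List.Relation.Binary.Permutation.Propositional using (_↭_)
open import Data.Fin using (Fin; toℕ)
open import Data.Vec using (Vec; toList)
import Data.List.Membership.DecPropositional as DecMem
open import Data.List.Membership.Propositional using (_∈_)
open import Relation.Binary.PropositionalEquality using (_≡_; _≢_)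
open import Relation.Binary using (DecidableEquality)
open import Relation.Nullary using (¬_)
open import Data.List using (lookup)
open import Data.Nat.ListAction using (sum)

IsPartition : List ℕ → Set
IsPartition ν = All (λ x → x > 0) ν × Linked _≥_ ν

-- Dominance α ≥ β : all partial sums of α dominate those of β
-- (parts beyond the length are 0, which `take` handles automatically).
Dominates : List ℕ → List ℕ → Set
Dominates α β = ∀ j → sum (take j β) ≤ sum (take j α)

-- conjugate: ν'_j = #{ i | ν_i ≥ j }, for j = 1 .. ν_1
largest : List ℕ → ℕ
largest []      = 0
largest (x ∷ _) = x

conj : List ℕ → List ℕ
conj ν = map (λ j → length (filter (λ x → suc j ≤? x) ν)) (upTo (largest ν))

Subpartition : List ℕ → List ℕ → Set
Subpartition ν λ′ = IsPartition ν × ∃ λ ρ → (ν ++ ρ) ↭ λ′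

Wide : List ℕ → Set
Wide λ′ = ∀ ν → Subpartition ν λ′ → Dominates ν (conj ν)

-- Finite graphs: a duplicate-free list of vertices with an adjacency relation

record FinGraph : Set₁ where
  field
    V     : Set
    _≟V_  : DecidableEquality V
    verts : List V
    Adj   : V → V → Set

module _ (G : FinGraph) where
  open FinGraph G
  open DecMem _≟V_ using (_∈?_)

  Complete : List V → Set
  Complete C = All (_∈ verts) C × AllPairs Adj C

  unionSize : List (List V) → ℕ
  unionSize Cs = length (filter (λ v → any? (λ C → v ∈? C) Cs) verts)

  -- a k-clique: a union of k complete subgraphs
  KClique : ℕ → Set
  KClique k = Σ (Vec (List V) k) λ Cs → All Complete (toList Cs)

  IsOmega : ℕ → ℕ → Set
  IsOmega k m =
    (Σ (KClique k) λ K → unionSize (toList (Data.Product.proj₁ K)) ≡ m)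
    × (∀ (K : KClique k) → unionSize (toList (Data.Product.proj₁ K)) ≤ m)

  Disjoint : List V → List V → Set
  Disjoint C D = ∀ {v} → v ∈ C → ¬ (v ∈ D)

  CliqueCover : List (List V) → Set
  CliqueCover Cs =
    All Complete Cs × AllPairs Disjoint Cs × All (λ v → Any (v ∈_) Cs) verts

  -- uniform: sizes sorted decreasingly ν₁ ≥ ν₂ ≥ ⋯ satisfy ν_k = Δω_k
  -- (k is 1-indexed in the paper; index i : Fin here corresponds to k = i+1)
  Uniform : List (List V) → Set
  Uniform Cs = Σ (List ℕ) λ ν →
    (ν ↭ map length Cs) × Linked _≥_ ν ×
    (∀ (i : Fin (length ν)) → ∃ λ a → ∃ λ b →
       IsOmega (suc (toℕ i)) a × IsOmega (toℕ i) b × a ≡ b + lookup ν i)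

-- Young diagram of λ : cells (i , j), 1 ≤ i ≤ ℓ(λ), 1 ≤ j ≤ λ_i

Cell : Set
Cell = ℕ × ℕ

rowCells : ℕ → ℕ → List Cell
rowCells i n = map (λ j → (i , suc j)) (upTo n)

rowsFrom : ℕ → List ℕ → List (List Cell)
rowsFrom i []       = []
rowsFrom i (l ∷ ls) = rowCells i l ∷ rowsFrom (suc i) ls

rows : List ℕ → List (List Cell)
rows λ′ = rowsFrom 1 λ′

cells : List ℕ → List Cell
cells λ′ = concat (rows λ′)

-- L(G_λ): distinct cells adjacent iff same row or same column
LAdj : Cell → Cell → Set
LAdj (i , j) (i′ , j′) = ((i , j) ≢ (i′ , j′)) × ((i ≡ i′) ⊎ (j ≡ j′))

LG : List ℕ → FinGraph
LG λ′ = record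
  { V = Cell ; _≟V_ = ≡-dec ℕP._≟_ ℕP._≟_ ; verts = cells λ′ ; Adj = LAdj }

{-# OPTIONS --safe #-}
module Submission where

-- A complete subgraph of L(G_λ) lies in a single row or column, so a k-clique is
-- covered by r rows R and c columns with r + c ≤ k.  A row outside R meets the
-- c columns in at most min(λ_i, c) cells, and for the subpartition μ of rows
-- outside R the sum of min(μ_i, c) is the sum of the first c parts of μ′, which
-- wideness bounds by the sum of the first c parts of μ.  As λ is decreasing, the
-- r chosen rows together with these c parts weigh at most λ_1 + ⋯ + λ_k, which
-- the first k rows attain: ω_k = λ_1 + ⋯ + λ_k, i.e. Δω_k = λ_k.

open import Defs
open import Data.List using (List)
open import Data.Nat using (ℕ)
open import Data.Product using (_×_)

open import Data.Empty using (⊥-elim)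
open import Data.Fin using (Fin; toℕ) renaming (zero to fzero; suc to fsuc)
open import Data.List using ([]; _∷_; _++_; [_]; _∷ʳ_; length; map; filter; concat; take; upTo; applyUpTo; lookup)
open import Data.List.Properties
  using (length-++; length-map; length-upTo; length-filter; filter-++; filter-all; map-cong; map-cong-local; take-map; upTo-∷ʳ)
open import Data.List.Membership.Propositional using (_∈_; _∉_)
open import Data.List.Membership.Propositional.Properties using (∈-∃++; ∈-filter⁻; ∈-map⁺; ∈-map⁻; ∈-concat⁺′; ∈-concat⁻)
open import Data.List.Membership.DecPropositional Data.Nat._≟_ using (_∈?_)
open import Data.List.Relation.Binary.Permutation.Propositional using (_↭_; ↭-refl; ↭-reflexive; ↭-prep; ↭-trans)
open import Data.List.Relation.Binary.Permutation.Propositional.Properties using (shift; ∈-resp-↭; ↭-length)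
open import Data.List.Relation.Binary.Subset.Propositional using (_⊆_)
open import Data.List.Relation.Binary.Sublist.Propositional using (⊆-refl)
import Data.List.Relation.Binary.Sublist.Propositional.Properties as Sublist
open import Data.List.Relation.Unary.All as All using (All; []; _∷_)
open import Data.List.Relation.Unary.Any using (Any; here; there)
open import Data.List.Relation.Unary.AllPairs as AllPairs using (AllPairs; []; _∷_)
import Data.List.Relation.Unary.AllPairs.Properties as AllPairs
open import Data.List.Relation.Unary.Linked as Linked using (Linked; []; _∷_)
open import Data.List.Relation.Unary.Linked.Properties using (Linked⇒AllPairs; AllPairs⇒Linked)
open import Data.List.Relation.Unary.Unique.Propositional using (Unique)
import Data.List.Relation.Unary.Unique.Propositional.Properties as Unique
open import Data.Nat using (zero; suc; _+_; _⊓_; _≤_; _≥_; _≤?_; z≤n; s≤s)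
open import Data.Nat.Properties
open import Algebra.Properties.CommutativeSemigroup +-commutativeSemigroup using (interchange; x∙yz≈y∙xz)
open import Data.Nat.ListAction using (sum)
open import Data.Product using (∃; ∃₂; _,_; proj₁; proj₂; uncurry)
open import Data.Sum as Sum using (_⊎_; inj₁; inj₂)
open import Data.Vec using (Vec; toList) renaming ([] to []ᵥ; _∷_ to _∷ᵥ_)
open import Function using (_∘_; flip)
open import Relation.Binary.PropositionalEquality using (_≡_; _≢_; refl; sym; trans; cong; cong₂; subst; module ≡-Reasoning)
open import Relation.Nullary using (Dec; yes; no)
open import Relation.Nullary.Decidable using (_⊎-dec_)
open import Relation.Unary using (Decidable)

module _ {A : Set} where

  ∈⇒↭∷ : ∀ {x : A} {ys} → x ∈ ys → ∃ λ zs → ys ↭ x ∷ zs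
  ∈⇒↭∷ x∈ys with as , bs , refl ← ∈-∃++ x∈ys = as ++ bs , shift _ as bs

  Unique-⊆⇒length≤ : ∀ {xs ys : List A} → Unique xs → xs ⊆ ys → length xs ≤ length ys
  Unique-⊆⇒length≤ {[]}     _            _     = z≤n
  Unique-⊆⇒length≤ {x ∷ xs} (x∉xs ∷ xs!) xs⊆ys with zs , ys↭ ← ∈⇒↭∷ (xs⊆ys (here refl)) =
    ≤-trans (s≤s (Unique-⊆⇒length≤ xs! xs⊆zs)) (≤-reflexive (sym (↭-length ys↭)))
    where
    xs⊆zs : xs ⊆ zs
    xs⊆zs y∈xs with ∈-resp-↭ ys↭ (xs⊆ys (there y∈xs))
    ... | here refl  = ⊥-elim (All.lookup x∉xs y∈xs refl)
    ... | there y∈zs = y∈zs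

  length-filter-mono : ∀ {P Q : A → Set} (P? : Decidable P) (Q? : Decidable Q) →
    (∀ {x} → P x → Q x) → ∀ xs → length (filter P? xs) ≤ length (filter Q? xs)
  length-filter-mono P? Q? P⇒Q xs =
    Sublist.length-mono-≤ (Sublist.filter⁺ P? Q? (λ { refl → P⇒Q }) (⊆-refl {x = xs}))

  length-filter-++ : ∀ {P : A → Set} (P? : Decidable P) xs ys →
    length (filter P? (xs ++ ys)) ≡ length (filter P? xs) + length (filter P? ys)
  length-filter-++ P? xs ys = trans (cong length (filter-++ P? xs ys)) (length-++ (filter P? xs))

indicator : ∀ {P : Set} → Dec P → ℕ
indicator (yes _) = 1
indicator (no _)  = 0

module _ {A : Set} {P : A → Set} (P? : Decidable P) where

  length-filter-∷ : ∀ x xs → length (filter P? (x ∷ xs)) ≡ indicator (P? x) + length (filter P? xs)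
  length-filter-∷ x xs with P? x
  ... | yes _ = refl
  ... | no _  = refl

  sum-indicator : ∀ xs → sum (map (indicator ∘ P?) xs) ≡ length (filter P? xs)
  sum-indicator []       = refl
  sum-indicator (x ∷ xs) =
    trans (cong (indicator (P? x) +_) (sum-indicator xs)) (sym (length-filter-∷ x xs))

module _ {A : Set} where

  sum-map-zero : ∀ (xs : List A) → sum (map (λ _ → 0) xs) ≡ 0
  sum-map-zero []       = refl
  sum-map-zero (_ ∷ xs) = sum-map-zero xs

  sum-map-+ : ∀ (f g : A → ℕ) xs → sum (map (λ x → f x + g x) xs) ≡ sum (map f xs) + sum (map g xs)
  sum-map-+ f g []       = refl
  sum-map-+ f g (x ∷ xs) =
    trans (cong (f x + g x +_) (sum-map-+ f g xs)) (interchange (f x) (g x) (sum (map f xs)) _)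

sum-length-filter-swap : ∀ {A B : Set} {P : A → B → Set} (P? : ∀ a b → Dec (P a b)) as bs →
  sum (map (λ a → length (filter (P? a) bs)) as) ≡ sum (map (λ b → length (filter (λ a → P? a b) as)) bs)
sum-length-filter-swap P? []       bs = sym (sum-map-zero bs)
sum-length-filter-swap P? (a ∷ as) bs = begin
  length (filter (P? a) bs) + sum (map (λ a → length (filter (P? a) bs)) as)
    ≡⟨ cong₂ _+_ (sym (sum-indicator (P? a) bs)) (sum-length-filter-swap P? as bs) ⟩
  sum (map (λ b → indicator (P? a b)) bs) + sum (map (λ b → length (filter (λ a → P? a b) as)) bs)
    ≡⟨ sum-map-+ _ _ bs ⟨
  sum (map (λ b → indicator (P? a b) + length (filter (λ a → P? a b) as)) bs)
    ≡⟨ cong sum (map-cong (λ b → length-filter-∷ (λ a → P? a b) a as) bs) ⟨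
  sum (map (λ b → length (filter (λ a → P? a b) (a ∷ as))) bs) ∎
  where open ≡-Reasoning

take-applyUpTo : ∀ {A : Set} (f : ℕ → A) c n → take c (applyUpTo f n) ≡ applyUpTo f (c ⊓ n)
take-applyUpTo f zero    n       = refl
take-applyUpTo f (suc c) zero    = refl
take-applyUpTo f (suc c) (suc n) = cong (f 0 ∷_) (take-applyUpTo (f ∘ suc) c n)

length-filter-<-upTo : ∀ x m → length (filter (λ j → suc j ≤? x) (upTo m)) ≡ x ⊓ m
length-filter-<-upTo x zero    = sym (⊓-zeroʳ x)
length-filter-<-upTo x (suc m) = begin
  length (filter (λ j → suc j ≤? x) (upTo (suc m)))
    ≡⟨ cong (length ∘ filter (λ j → suc j ≤? x)) (upTo-∷ʳ m) ⟨
  length (filter (λ j → suc j ≤? x) (upTo m ∷ʳ m))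
    ≡⟨ length-filter-++ (λ j → suc j ≤? x) (upTo m) [ m ] ⟩
  length (filter (λ j → suc j ≤? x) (upTo m)) + length (filter (λ j → suc j ≤? x) [ m ])
    ≡⟨ cong₂ _+_ (length-filter-<-upTo x m) (trans (length-filter-∷ (λ j → suc j ≤? x) m []) (+-identityʳ _)) ⟩
  x ⊓ m + indicator (suc m ≤? x)
    ≡⟨ m⊓n+[n<m]≡m⊓1+n ⟩
  x ⊓ suc m ∎
  where
  open ≡-Reasoning
  m⊓n+[n<m]≡m⊓1+n : x ⊓ m + indicator (suc m ≤? x) ≡ x ⊓ suc m
  m⊓n+[n<m]≡m⊓1+n with suc m ≤? x
  ... | yes m<x = begin
    x ⊓ m + 1 ≡⟨ cong (_+ 1) (m≥n⇒m⊓n≡n (<⇒≤ m<x)) ⟩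
    m + 1     ≡⟨ +-comm m 1 ⟩
    suc m     ≡⟨ m≥n⇒m⊓n≡n m<x ⟨
    x ⊓ suc m ∎
  ... | no m≮x = begin
    x ⊓ m + 0 ≡⟨ +-identityʳ _ ⟩
    x ⊓ m     ≡⟨ m≤n⇒m⊓n≡m (≮⇒≥ m≮x) ⟩
    x         ≡⟨ m≤n⇒m⊓n≡m (m≤n⇒m≤1+n (≮⇒≥ m≮x)) ⟨
    x ⊓ suc m ∎

≤-largest : ∀ {μ} → AllPairs _≥_ μ → All (_≤ largest μ) μ
≤-largest []         = []
≤-largest (x≥xs ∷ _) = ≤-refl ∷ x≥xs

-- Count the cells in the first c columns of μ by columns and by rows.
sum-take-conj : ∀ μ → All (_≤ largest μ) μ → ∀ c → sum (take c (conj μ)) ≡ sum (map (_⊓ c) μ)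
sum-take-conj μ μ≤L c = begin
  sum (take c (map column (upTo L)))
    ≡⟨ cong sum (take-map c (upTo L)) ⟩
  sum (map column (take c (upTo L)))
    ≡⟨ cong (sum ∘ map column) (take-applyUpTo (λ j → j) c L) ⟩
  sum (map column (upTo (c ⊓ L)))
    ≡⟨ sum-length-filter-swap (λ j x → suc j ≤? x) (upTo (c ⊓ L)) μ ⟩
  sum (map (λ x → length (filter (λ j → suc j ≤? x) (upTo (c ⊓ L)))) μ)
    ≡⟨ cong sum (map-cong (λ x → length-filter-<-upTo x (c ⊓ L)) μ) ⟩
  sum (map (_⊓ (c ⊓ L)) μ)
    ≡⟨ cong sum (map-cong-local (All.map ⊓-bounded μ≤L)) ⟩
  sum (map (_⊓ c) μ) ∎
  where
  open ≡-Reasoning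
  L = largest μ
  column : ℕ → ℕ
  column j = length (filter (λ x → suc j ≤? x) μ)
  ⊓-bounded : ∀ {x} → x ≤ L → x ⊓ (c ⊓ L) ≡ x ⊓ c
  ⊓-bounded {x} x≤L = begin
    x ⊓ (c ⊓ L) ≡⟨ cong (x ⊓_) (⊓-comm c L) ⟩
    x ⊓ (L ⊓ c) ≡⟨ ⊓-assoc x L c ⟨
    x ⊓ L ⊓ c   ≡⟨ cong (_⊓ c) (m≤n⇒m⊓n≡m x≤L) ⟩
    x ⊓ c       ∎

sum-take-mono : ∀ xs {m n} → m ≤ n → sum (take m xs) ≤ sum (take n xs)
sum-take-mono xs       z≤n       = z≤n
sum-take-mono []       (s≤s _)   = z≤n
sum-take-mono (x ∷ xs) (s≤s m≤n) = +-monoʳ-≤ x (sum-take-mono xs m≤n)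

sum-take-tail≤ : ∀ {x xs} → Linked _≥_ (x ∷ xs) → ∀ n → sum (take n xs) ≤ sum (take n (x ∷ xs))
sum-take-tail≤               _             zero    = z≤n
sum-take-tail≤ {xs = []}     _             (suc n) = z≤n
sum-take-tail≤ {xs = y ∷ ys} (x≥y ∷ y∷ys↓) (suc n) = +-mono-≤ x≥y (sum-take-tail≤ y∷ys↓ n)

module _ (R : List ℕ) where

  selected unselected : ℕ → List ℕ → List ℕ
  selected i []       = []
  selected i (l ∷ ls) with i ∈? R
  ... | yes _ = l ∷ selected (suc i) ls
  ... | no  _ = selected (suc i) ls
  unselected i []       = []
  unselected i (l ∷ ls) with i ∈? R
  ... | yes _ = unselected (suc i) ls
  ... | no  _ = l ∷ unselected (suc i) ls

  unselected++selected↭ : ∀ i ls → unselected i ls ++ selected i ls ↭ ls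
  unselected++selected↭ i []       = ↭-refl
  unselected++selected↭ i (l ∷ ls) with i ∈? R
  ... | yes _ = ↭-trans (shift l (unselected (suc i) ls) (selected (suc i) ls))
                        (↭-prep l (unselected++selected↭ (suc i) ls))
  ... | no  _ = ↭-prep l (unselected++selected↭ (suc i) ls)

  All-unselected : ∀ {P : ℕ → Set} i {ls} → All P ls → All P (unselected i ls)
  All-unselected i {[]}     []         = []
  All-unselected i {l ∷ ls} (pl ∷ pls) with i ∈? R
  ... | yes _ = All-unselected (suc i) pls
  ... | no  _ = pl ∷ All-unselected (suc i) pls

  AllPairs-unselected : ∀ {_~_ : ℕ → ℕ → Set} i {ls} → AllPairs _~_ ls → AllPairs _~_ (unselected i ls)
  AllPairs-unselected i {[]}     []         = []
  AllPairs-unselected i {l ∷ ls} (l~ls ∷ ls~) with i ∈? R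
  ... | yes _ = AllPairs-unselected (suc i) ls~
  ... | no  _ = All-unselected (suc i) l~ls ∷ AllPairs-unselected (suc i) ls~

  length-selected≤ : ∀ i ls {R′} → (∀ {j} → i ≤ j → j ∈ R → j ∈ R′) → length (selected i ls) ≤ length R′
  length-selected≤ i []       _     = z≤n
  length-selected≤ i (l ∷ ls) R⊆R′ with i ∈? R
  ... | no  _   = length-selected≤ (suc i) ls (R⊆R′ ∘ <⇒≤)
  ... | yes i∈R with R″ , R′↭ ← ∈⇒↭∷ (R⊆R′ ≤-refl i∈R) =
    ≤-trans (s≤s (length-selected≤ (suc i) ls R⊆R″)) (≤-reflexive (sym (↭-length R′↭)))
    where
    R⊆R″ : ∀ {j} → suc i ≤ j → j ∈ R → j ∈ R″
    R⊆R″ i<j j∈R with ∈-resp-↭ R′↭ (R⊆R′ (<⇒≤ i<j) j∈R)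
    ... | here refl  = ⊥-elim (<-irrefl refl i<j)
    ... | there j∈R″ = j∈R″

  -- The selected parts and the first c unselected ones sit at distinct positions of ls.
  sum-selected+sum-take-unselected≤ : ∀ i {ls} → Linked _≥_ ls → ∀ c →
    sum (selected i ls) + sum (take c (unselected i ls)) ≤ sum (take (length (selected i ls) + c) ls)
  sum-selected+sum-take-unselected≤ i {[]}     _    zero    = z≤n
  sum-selected+sum-take-unselected≤ i {[]}     _    (suc c) = z≤n
  sum-selected+sum-take-unselected≤ i {l ∷ ls} l∷ls↓ c with i ∈? R | c
  ... | yes _ | c     = ≤-trans (≤-reflexive (+-assoc l _ _))
                              (+-monoʳ-≤ l (sum-selected+sum-take-unselected≤ (suc i) (Linked.tail l∷ls↓) c))
  ... | no _  | zero  = ≤-trans (sum-selected+sum-take-unselected≤ (suc i) (Linked.tail l∷ls↓) 0)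
                              (sum-take-tail≤ l∷ls↓ (length (selected (suc i) ls) + 0))
  ... | no _  | suc c = begin
    sum S + (l + sum (take c U))           ≡⟨ x∙yz≈y∙xz (sum S) l _ ⟩
    l + (sum S + sum (take c U))           ≤⟨ +-monoʳ-≤ l (IH c) ⟩
    l + sum (take (length S + c) ls)       ≡⟨ cong (λ n → sum (take n (l ∷ ls))) (+-suc (length S) c) ⟨
    sum (take (length S + suc c) (l ∷ ls)) ∎
    where
    open ≤-Reasoning
    S U : List ℕ
    S = selected (suc i) ls
    U = unselected (suc i) ls
    IH : ∀ c → sum S + sum (take c U) ≤ sum (take (length S + c) ls)
    IH = sum-selected+sum-take-unselected≤ (suc i) (Linked.tail l∷ls↓)

Line : Set
Line = ℕ ⊎ ℕ

OnLine : Line → Cell → Set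
OnLine (inj₁ i) (i′ , _) = i′ ≡ i
OnLine (inj₂ j) (_ , j′) = j′ ≡ j

adjacent-to-row-pair⇒on-row : ∀ {a b d w} → (a , b) ≢ (a , d) →
  LAdj (a , b) w → LAdj (a , d) w → OnLine (inj₁ a) w
adjacent-to-row-pair⇒on-row _   (_ , inj₁ refl) _               = refl
adjacent-to-row-pair⇒on-row _   (_ , inj₂ _)    (_ , inj₁ refl) = refl
adjacent-to-row-pair⇒on-row b≢d (_ , inj₂ refl) (_ , inj₂ refl) = ⊥-elim (b≢d refl)

adjacent-to-column-pair⇒on-column : ∀ {a b c w} → (a , b) ≢ (c , b) →
  LAdj (a , b) w → LAdj (c , b) w → OnLine (inj₂ b) w
adjacent-to-column-pair⇒on-column _   (_ , inj₂ refl) _               = refl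
adjacent-to-column-pair⇒on-column _   (_ , inj₁ _)    (_ , inj₂ refl) = refl
adjacent-to-column-pair⇒on-column a≢c (_ , inj₁ refl) (_ , inj₁ refl) = ⊥-elim (a≢c refl)

complete⇒on-line : ∀ {K} → AllPairs LAdj K → ∃ λ L → All (OnLine L) K
complete⇒on-line {[]}          _ = inj₁ 0 , []
complete⇒on-line {(a , _) ∷ []} _ = inj₁ a , refl ∷ []
complete⇒on-line {(a , b) ∷ (c , d) ∷ _} (((u≢v , inj₁ refl) ∷ u~K) ∷ (v~K ∷ _)) =
  inj₁ a , refl ∷ refl ∷ All.zipWith (uncurry (adjacent-to-row-pair⇒on-row u≢v)) (u~K , v~K)
complete⇒on-line {(a , b) ∷ (c , d) ∷ _} (((u≢v , inj₂ refl) ∷ u~K) ∷ (v~K ∷ _)) =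
  inj₂ b , refl ∷ refl ∷ All.zipWith (uncurry (adjacent-to-column-pair⇒on-column u≢v)) (u~K , v~K)

OnLines : List ℕ → List ℕ → Cell → Set
OnLines R C (i , j) = i ∈ R ⊎ j ∈ C

onLines? : ∀ R C → Decidable (OnLines R C)
onLines? R C (i , j) = i ∈? R ⊎-dec j ∈? C

kClique⊆lines : ∀ {k} (Ks : Vec (List Cell) k) → All (AllPairs LAdj) (toList Ks) →
  ∃₂ λ R C → length R + length C ≤ k × (∀ {v} → Any (v ∈_) (toList Ks) → OnLines R C v)
kClique⊆lines []ᵥ [] = [] , [] , z≤n , λ ()
kClique⊆lines (K ∷ᵥ Ks) (K-clique ∷ Ks-cliques)
  with R , C , r+c≤k , Ks⊆lines ← kClique⊆lines Ks Ks-cliques | complete⇒on-line K-clique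
... | inj₁ i , K-on-i = i ∷ R , C , s≤s r+c≤k , K∷Ks⊆lines
  where
  K∷Ks⊆lines : ∀ {v} → Any (v ∈_) (K ∷ toList Ks) → OnLines (i ∷ R) C v
  K∷Ks⊆lines (here v∈K)   = inj₁ (here (All.lookup K-on-i v∈K))
  K∷Ks⊆lines (there v∈Ks) = Sum.map₁ there (Ks⊆lines v∈Ks)
... | inj₂ j , K-on-j = R , j ∷ C , ≤-trans (≤-reflexive (+-suc _ _)) (s≤s r+c≤k) , K∷Ks⊆lines
  where
  K∷Ks⊆lines : ∀ {v} → Any (v ∈_) (K ∷ toList Ks) → OnLines R (j ∷ C) v
  K∷Ks⊆lines (here v∈K)   = inj₂ (here (All.lookup K-on-j v∈K))
  K∷Ks⊆lines (there v∈Ks) = Sum.map₂ there (Ks⊆lines v∈Ks)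

row-of-rowCells : ∀ {i l v} → v ∈ rowCells i l → proj₁ v ≡ i
row-of-rowCells {i} v∈row with _ , _ , refl ← ∈-map⁻ (λ j → (i , suc j)) v∈row = refl

rowCells-unique : ∀ i l → Unique (rowCells i l)
rowCells-unique i l = Unique.map⁺ {f = λ j → (i , suc j)} (suc-injective ∘ cong proj₂) (Unique.upTo⁺ l)

length-rowCells : ∀ i l → length (rowCells i l) ≡ l
length-rowCells i l = trans (length-map _ (upTo l)) (length-upTo l)

module _ (R C : List ℕ) where

  row-on-lines≤ : ∀ i l → length (filter (onLines? R C) (rowCells i l)) ≤ l
  row-on-lines≤ i l = ≤-trans (length-filter (onLines? R C) (rowCells i l)) (≤-reflexive (length-rowCells i l))

  -- Off the rows R, the cells of a row on the lines have distinct columns, all in C.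
  row∉R-on-lines≤ : ∀ {i} l → i ∉ R → length (filter (onLines? R C) (rowCells i l)) ≤ length C
  row∉R-on-lines≤ {i} l i∉R =
    ≤-trans (Unique-⊆⇒length≤ (Unique.filter⁺ (onLines? R C) (rowCells-unique i l)) ⊆row-i-of-C)
            (≤-reflexive (length-map (i ,_) C))
    where
    ⊆row-i-of-C : filter (onLines? R C) (rowCells i l) ⊆ map (i ,_) C
    ⊆row-i-of-C v∈ with ∈-filter⁻ (onLines? R C) {xs = rowCells i l} v∈
    ... | v∈row , v-on with ∈-map⁻ (λ j → (i , suc j)) v∈row
    ...   | _ , _ , refl = Sum.[ ⊥-elim ∘ i∉R , ∈-map⁺ (i ,_) ]′ v-on

  cells-on-lines≤ : ∀ i ls → length (filter (onLines? R C) (concat (rowsFrom i ls))) ≤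
    sum (selected R i ls) + sum (map (_⊓ length C) (unselected R i ls))
  cells-on-lines≤ i []       = z≤n
  cells-on-lines≤ i (l ∷ ls)
    rewrite length-filter-++ (onLines? R C) (rowCells i l) (concat (rowsFrom (suc i) ls))
    with i ∈? R
  ... | yes _   = ≤-trans (+-mono-≤ (row-on-lines≤ i l) (cells-on-lines≤ (suc i) ls))
                          (≤-reflexive (sym (+-assoc l _ _)))
  ... | no  i∉R = ≤-trans (+-mono-≤ (⊓-glb (row-on-lines≤ i l) (row∉R-on-lines≤ l i∉R))
                                   (cells-on-lines≤ (suc i) ls))
                          (≤-reflexive (x∙yz≈y∙xz (l ⊓ length C) (sum (selected R (suc i) ls)) _))

unionSize≤sum-take : ∀ λ′ → IsPartition λ′ → Wide λ′ → ∀ k (K : KClique (LG λ′) k) →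
  unionSize (LG λ′) (toList (proj₁ K)) ≤ sum (take k λ′)
unionSize≤sum-take λ′ (λ′>0 , λ′↓) wide k (Ks , Ks-complete)
  with R , C , r+c≤k , Ks⊆lines ← kClique⊆lines Ks (All.map proj₂ Ks-complete) = begin
  unionSize (LG λ′) (toList Ks)             ≤⟨ length-filter-mono _ (onLines? R C) Ks⊆lines (cells λ′) ⟩
  length (filter (onLines? R C) (cells λ′)) ≤⟨ cells-on-lines≤ R C 1 λ′ ⟩
  sum S + sum (map (_⊓ c) μ)                ≡⟨ cong (sum S +_) (sum-take-conj μ (≤-largest μ↓) c) ⟨
  sum S + sum (take c (conj μ))             ≤⟨ +-monoʳ-≤ (sum S) (wide μ μ-subpartition c) ⟩
  sum S + sum (take c μ)                    ≤⟨ sum-selected+sum-take-unselected≤ R 1 λ′↓ c ⟩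
  sum (take (length S + c) λ′)              ≤⟨ sum-take-mono λ′ s+c≤k ⟩
  sum (take k λ′)                           ∎
  where
  open ≤-Reasoning
  S μ : List ℕ
  S = selected R 1 λ′
  μ = unselected R 1 λ′
  c : ℕ
  c = length C
  μ↓ : AllPairs _≥_ μ
  μ↓ = AllPairs-unselected R 1 (Linked⇒AllPairs (flip ≤-trans) λ′↓)
  μ-subpartition : Subpartition μ λ′
  μ-subpartition = (All-unselected R 1 λ′>0 , AllPairs⇒Linked μ↓) , S , unselected++selected↭ R 1 λ′
  s+c≤k : length S + c ≤ k
  s+c≤k = ≤-trans (+-monoˡ-≤ c (length-selected≤ R 1 λ′ (λ _ j∈R → j∈R))) r+c≤k

takePadded : ∀ {A : Set} k → List (List A) → Vec (List A) k
takePadded zero    _        = []ᵥ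
takePadded (suc k) []       = [] ∷ᵥ takePadded k []
takePadded (suc k) (r ∷ rs) = r ∷ᵥ takePadded k rs

All-takePadded : ∀ {A : Set} {P : List A → Set} k {rs} → P [] → All P rs → All P (toList (takePadded k rs))
All-takePadded zero    {rs}     _   _          = []
All-takePadded (suc k) {[]}     p[] []         = p[] ∷ All-takePadded k p[] []
All-takePadded (suc k) {r ∷ rs} p[] (pr ∷ prs) = pr ∷ All-takePadded k p[] prs

sum-take-lengths≤ : ∀ {A : Set} {P : A → Set} (P? : Decidable P) k rs →
  (∀ {v} → Any (v ∈_) (toList (takePadded k rs)) → P v) →
  sum (take k (map length rs)) ≤ length (filter P? (concat rs))
sum-take-lengths≤ P? zero    rs       _       = z≤n
sum-take-lengths≤ P? (suc k) []       _       = z≤n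
sum-take-lengths≤ P? (suc k) (r ∷ rs) covered = begin
  length r + sum (take k (map length rs))
    ≤⟨ +-monoʳ-≤ (length r) (sum-take-lengths≤ P? k rs (covered ∘ there)) ⟩
  length r + length (filter P? (concat rs))
    ≡⟨ cong (λ r′ → length r′ + _) (filter-all P? (All.tabulate (covered ∘ here))) ⟨
  length (filter P? r) + length (filter P? (concat rs))
    ≡⟨ length-filter-++ P? r (concat rs) ⟨
  length (filter P? (r ++ concat rs)) ∎
  where open ≤-Reasoning

lengths-rowsFrom : ∀ i ls → map length (rowsFrom i ls) ≡ ls
lengths-rowsFrom i []       = refl
lengths-rowsFrom i (l ∷ ls) = cong₂ _∷_ (length-rowCells i l) (lengths-rowsFrom (suc i) ls)

rowCells-adjacent : ∀ i l → AllPairs LAdj (rowCells i l)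
rowCells-adjacent i l =
  AllPairs.map⁺ (AllPairs.map (λ j≢j′ → j≢j′ ∘ suc-injective ∘ cong proj₂ , inj₁ refl) (Unique.upTo⁺ l))

rowsFrom-adjacent : ∀ i ls → All (AllPairs LAdj) (rowsFrom i ls)
rowsFrom-adjacent i []       = []
rowsFrom-adjacent i (l ∷ ls) = rowCells-adjacent i l ∷ rowsFrom-adjacent (suc i) ls

rows-complete : ∀ λ′ → All (Complete (LG λ′)) (rows λ′)
rows-complete λ′ = All.tabulate λ r∈rows →
  All.tabulate (λ v∈r → ∈-concat⁺′ v∈r r∈rows) , All.lookup (rowsFrom-adjacent 1 λ′) r∈rows

rowsFrom-rows≥ : ∀ i ls → All (All (λ v → i ≤ proj₁ v)) (rowsFrom i ls)
rowsFrom-rows≥ i []       = []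
rowsFrom-rows≥ i (l ∷ ls) =
  All.tabulate (≤-reflexive ∘ sym ∘ row-of-rowCells) ∷ All.map (All.map <⇒≤) (rowsFrom-rows≥ (suc i) ls)

rowsFrom-disjoint : ∀ λ′ i ls → AllPairs (Disjoint (LG λ′)) (rowsFrom i ls)
rowsFrom-disjoint λ′ i []       = []
rowsFrom-disjoint λ′ i (l ∷ ls) =
  All.map below (rowsFrom-rows≥ (suc i) ls) ∷ rowsFrom-disjoint λ′ (suc i) ls
  where
  below : ∀ {D} → All (λ v → suc i ≤ proj₁ v) D → Disjoint (LG λ′) (rowCells i l) D
  below D-below v∈row v∈D = <-irrefl (sym (row-of-rowCells v∈row)) (All.lookup D-below v∈D)

rows-cliqueCover : ∀ λ′ → CliqueCover (LG λ′) (rows λ′)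
rows-cliqueCover λ′ = rows-complete λ′ , rowsFrom-disjoint λ′ 1 λ′ , All.tabulate (∈-concat⁻ (rows λ′))

isOmega-sum-take : ∀ λ′ → IsPartition λ′ → Wide λ′ → ∀ k → IsOmega (LG λ′) k (sum (take k λ′))
isOmega-sum-take λ′ λ′-partition wide k =
  (firstRows , ≤-antisym (unionSize≤sum-take λ′ λ′-partition wide k firstRows) firstRows≥) ,
  unionSize≤sum-take λ′ λ′-partition wide k
  where
  firstRows : KClique (LG λ′) k
  firstRows = takePadded k (rows λ′) , All-takePadded k ([] , []) (rows-complete λ′)
  firstRows≥ : sum (take k λ′) ≤ unionSize (LG λ′) (toList (proj₁ firstRows))
  firstRows≥ = subst (λ ls → sum (take k ls) ≤ unionSize (LG λ′) (toList (proj₁ firstRows)))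
                     (lengths-rowsFrom 1 λ′) (sum-take-lengths≤ _ k (rows λ′) (λ v∈ → v∈))

sum-take-suc : ∀ (xs : List ℕ) (i : Fin (length xs)) →
  sum (take (suc (toℕ i)) xs) ≡ sum (take (toℕ i) xs) + lookup xs i
sum-take-suc (x ∷ xs) fzero    = +-comm x 0
sum-take-suc (x ∷ xs) (fsuc i) = trans (cong (x +_) (sum-take-suc xs i)) (sym (+-assoc x _ _))

lemma3 : (λ′ : List ℕ) → IsPartition λ′ → Wide λ′ →
    CliqueCover (LG λ′) (rows λ′) × Uniform (LG λ′) (rows λ′)
lemma3 λ′ λ′-partition wide =
  rows-cliqueCover λ′ ,
  (λ′ , ↭-reflexive (sym (lengths-rowsFrom 1 λ′)) , proj₂ λ′-partition , Δω≡λ)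
  where
  ω : ∀ k → IsOmega (LG λ′) k (sum (take k λ′))
  ω = isOmega-sum-take λ′ λ′-partition wide
  Δω≡λ : ∀ (i : Fin (length λ′)) → ∃₂ λ a b →
    IsOmega (LG λ′) (suc (toℕ i)) a × IsOmega (LG λ′) (toℕ i) b × a ≡ b + lookup λ′ i
  Δω≡λ i = _ , _ , ω (suc (toℕ i)) , ω (toℕ i) , sum-take-suc λ′ i
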